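{- Let $p$ be an odd prime, $\omega=e^{2\pi i/p}$, $K=\mathbb{Q}(\omega)$, $N$ a positive integer and $B(p,N)=\{a_1\omega+\cdots+a_{p-1}\omega^{p-1}: a_i\in\mathbb{Z}\cap[-N,N]\}$. Then $$M_2(p,N):=\frac{1}{\#B(p,N)^2}\sum_{\alpha\in B(p,N)}\sum_{\beta\in B(p,N)}d(\alpha,\beta)^2=\frac{2}{3}(p^3-2p^2+1)N(N+1)=\frac{2}{3}p^3N^2+O(p^2N^2+p^3N),$$ where the implied constant is absolute.
   Context: $\operatorname{Tr}_{K/\mathbb{Q}}(\alpha)=\sum_{\sigma\in\operatorname{Gal}(K/\mathbb{Q})}\sigma(\alpha)$. For $\alpha\in K$, $\|\alpha\|=\sqrt{\sum_{j=1}^{p-1}\operatorname{Tr}_{K/\mathbb{Q}}(\alpha\omega^j)^2}$, and $d(\alpha,\beta)=\|\alpha-\beta\|$. $f=O(g)$ means $|f|\le C|g|$ for an absolute constant $C$. -}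

module Defs where

open import Data.Nat as ℕ using (ℕ; zero; suc; NonZero)
open import Data.Nat.Properties using (m^n≢0)
open import Data.Nat.DivMod using (_%_; m%n<n)
open import Data.Integer as ℤ using (ℤ; +_; _-_; _+_; _*_; -_)
open import Data.Fin using (Fin; toℕ; fromℕ<)
open import Data.List using (List; []; _∷_; map; upTo; concatMap; foldr)
open import Data.Bool using (if_then_else_)
open import Data.Rational as ℚ using (ℚ)

-- Model of the ring ℤ[ω], ω = e^{2πi/p}:  an element is a coefficient
-- function c : Fin p → ℤ standing for  Σ_{k=0}^{p-1} c k · ω^k,
-- where ω^p = 1 and 1 + ω + ... + ω^{p-1} = 0 (so representations are
-- unique up to adding a constant vector).
Elt : ℕ → Set
Elt p = Fin p → ℤ

ΣFin : (n : ℕ) → (Fin n → ℤ) → ℤ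
ΣFin zero    f = + 0
ΣFin (suc n) f = f Fin.zero + ΣFin n (λ i → f (Fin.suc i))
  where import Data.Fin as Fin

Σrange : ℕ → ℕ → (ℕ → ℤ) → ℤ
Σrange a b f = foldr (λ i s → f (a ℕ.+ i) + s) (+ 0) (upTo (b ℕ.∸ a))

module _ (p : ℕ) .{{_ : NonZero p}} where

  idx : ℕ → Fin p
  idx k = fromℕ< (m%n<n k p)

  -- push-forward of a coefficient vector along an exponent map g:
  -- Σ c m ω^m  ↦  Σ c m ω^(g m)
  push : (Fin p → Fin p) → Elt p → Elt p
  push g c k = ΣFin p (λ m → if toℕ (g m) ℕ.≡ᵇ toℕ k then c m else + 0)

  _⊕_ : Elt p → Elt p → Elt p
  (a ⊕ b) k = a k + b k

  _⊖_ : Elt p → Elt p → Elt p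
  (a ⊖ b) k = a k - b k

  zeroE : Elt p
  zeroE k = + 0

  mulω : ℕ → Elt p → Elt p
  mulω j = push (λ m → idx (toℕ m ℕ.+ j))

  -- the Galois automorphism σ_k : ω ↦ ω^k   (Gal(K/ℚ) = {σ_k : 1 ≤ k ≤ p-1})
  σ : ℕ → Elt p → Elt p
  σ k = push (λ m → idx (toℕ m ℕ.* k))

  TrE : Elt p → Elt p
  TrE α = foldr (λ k s → σ k α ⊕ s) zeroE (Data.List.map suc (upTo (p ℕ.∸ 1)))
    where import Data.List

  -- The trace is a rational (integer) number r; in ℤ[ω] its representation
  -- is c with c 1 = ... = c (p-1), and r = c 0 - c 1 (since
  -- ω + ... + ω^{p-1} = -1).  This reads off that integer.
  ratPart : Elt p → ℤ
  ratPart c = c (idx 0) - c (idx 1)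

  Tr : Elt p → ℤ
  Tr α = ratPart (TrE α)

  norm² : Elt p → ℤ
  norm² α = Σrange 1 p (λ j → Tr (mulω j α) * Tr (mulω j α))

  dist² : Elt p → Elt p → ℤ
  dist² α β = norm² (α ⊖ β)

  box : (n : ℕ) → (Fin n → List ℤ) → List (Fin n → ℤ)
  box zero    opts = (λ ()) ∷ []
  box (suc n) opts =
    concatMap (λ x → map (λ f → cons x f) (box n (λ i → opts (Fin.suc i)))) (opts Fin.zero)
    where
      import Data.Fin as Fin
      cons : ∀ {n} → ℤ → (Fin n → ℤ) → Fin (suc n) → ℤ
      cons x f Fin.zero    = x
      cons x f (Fin.suc i) = f i

  range : ℕ → List ℤ
  range N = map (λ i → + i - + N) (upTo (suc (2 ℕ.* N)))

  -- B(p,N) = { a₁ω + ... + a_{p-1}ω^{p-1} : a_i ∈ ℤ ∩ [-N,N] }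
  -- (coefficient of ω^0 is 0; distinct tuples give distinct elements
  --  since ω,...,ω^{p-1} is a ℚ-basis of K)
  B : ℕ → List (Elt p)
  B N = box p (λ k → if toℕ k ℕ.≡ᵇ 0 then (+ 0 ∷ []) else range N)

  ΣList : {A : Set} → List A → (A → ℤ) → ℤ
  ΣList xs f = foldr (λ x s → f x + s) (+ 0) xs

  cardB : ℕ → ℕ
  cardB N = suc (2 ℕ.* N) ℕ.^ (p ℕ.∸ 1)

  M₂ : ℕ → ℚ
  M₂ N = ℚ._/_ (ΣList (B N) (λ α → ΣList (B N) (λ β → dist² α β)))
               (cardB N ℕ.* cardB N) {{nz}}
    where
      open import Data.Nat.Properties using (m*n≢0)
      nz : NonZero (cardB N ℕ.* cardB N)
      nz = m*n≢0 (cardB N) (cardB N) {{m^n≢0 (suc (2 ℕ.* N)) (p ℕ.∸ 1)}} {{m^n≢0 (suc (2 ℕ.* N)) (p ℕ.∸ 1)}}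

{-# OPTIONS --safe #-}
module Submission where

-- Write α ∈ ℤ[ω] as Σ c_m ω^m. As p is prime, for m ≢ 0 the exponents m k (1 ≤ k < p) run once
-- through the nonzero residues, so Σ_k σ_k(α) has coefficient (p-1) c₀ at ω⁰ and Σ_{m≢0} c_m at ω¹;
-- hence Tr α = p c₀ - Σ_m c_m and Tr(ω^j γ) = p γ_{p-j} - Σ_m γ_m. For γ = α - β with α, β ∈ B(p,N)
-- (so γ₀ = 0) this gives d(α,β)² = p² Σ_k γ_k² - (p+1) (Σ_k γ_k)².
-- Summed over all pairs in the cube B(p,N) = [-N,N]^{p-1}, the cross terms γ_k γ_l (k ≢ l) cancel, so
-- both sums equal (p-1) (2N+1)^{2(p-2)} Σ_{x,y ∈ [-N,N]} (x-y)², and Σ_{x,y} (x-y)² = ⅔ (2N+1)² N(N+1).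
-- Dividing by #B² = (2N+1)^{2(p-1)} and using (p²-p-1)(p-1) = p³-2p²+1 gives M₂; the deviation from
-- ⅔ p³N² is at most 2 (p²N² + p³N).

open import Defs
open import Function using (_∘_; id)
open import Data.Bool using (true; false; T; if_then_else_)
open import Data.Product using (∃; ∃₂; _×_; _,_)
open import Data.Sum using (inj₁; inj₂)
open import Data.List using (List; []; _∷_; _++_; map; concatMap; foldr; applyUpTo; upTo; length)
import Data.List.Properties as List
open import Data.Fin as Fin using (Fin; zero; suc; toℕ; punchOut; opposite)
import Data.Fin.Properties as Fin
import Data.Fin.Permutation as Perm
open import Data.Nat as ℕ using (ℕ; zero; suc; NonZero; z≤n; s≤s; _∸_; _^_)
import Data.Nat.Properties as ℕP
open import Data.Nat.Divisibility using (_∣_; divides; m%n≡0⇒n∣m; >⇒∤)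
open import Data.Nat.Primality using (Prime; prime⇒nonZero; euclidsLemma; ¬prime[0]; ¬prime[1])
open import Data.Integer as ℤ using (ℤ; +_; +0; -[1+_])
import Data.Integer.Properties as ℤP
open import Algebra.Properties.Semiring.Sum ℤP.+-*-semiring
  using (sum; sum-syntax; sum-cong-≗; sum-remove; sum-replicate-zero; ∑-comm; ∑-distrib-+; *-distribˡ-sum; ∑-permute)
open import Data.Rational as ℚ using (ℚ; toℚᵘ)
import Data.Rational.Properties as ℚP
open import Data.Rational.Unnormalised as ℚᵘ using (mkℚᵘ; *≡*; *≤*) renaming (_≃_ to _≃ᵘ_)
import Data.Rational.Unnormalised.Properties as ℚᵘP
open import Relation.Binary.PropositionalEquality
open import Relation.Nullary using (yes; no; contradiction)

-- Integer arithmetic is opened only inside this block: the theorem at the end is stated with the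
-- rational operators of the same names.
module _ where

  open import Data.Integer using (_+_; _*_; _-_; -_)
  open import Data.Nat.DivMod using (_%_; _/_; m≡m%n+[m/n]*n; m<n⇒m%n≡m; n%n≡0)
  open import Data.Integer.Tactic.RingSolver using (solve-∀)
  import Data.Nat.Tactic.RingSolver as ℕ-Solver

  sq : ℤ → ℤ
  sq x = x * x

  ΣFin≡sum : ∀ n (f : Fin n → ℤ) → ΣFin n f ≡ sum f
  ΣFin≡sum zero    f = refl
  ΣFin≡sum (suc n) f = cong (λ s → f zero + s) (ΣFin≡sum n (f ∘ suc))

  ∑-const : ∀ n (c : ℤ) → ∑[ i < n ] c ≡ + n * c
  ∑-const zero    c = refl
  ∑-const (suc n) c = trans (cong (λ s → c + s) (∑-const n c)) (step c (+ n))
    where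
    step : ∀ c m → c + m * c ≡ (+ 1 + m) * c
    step = solve-∀

  ∑-single : ∀ {n} (f : Fin n → ℤ) (i₀ : Fin n) → (∀ i → i ≢ i₀ → f i ≡ +0) → sum f ≡ f i₀
  ∑-single {suc n} f i₀ f≡0 = begin
    sum f                                   ≡⟨ sum-remove {i = i₀} f ⟩
    f i₀ + ∑[ j < n ] f (Fin.punchIn i₀ j)  ≡⟨ cong (λ s → f i₀ + s) rest≡0 ⟩
    f i₀ + +0                               ≡⟨ ℤP.+-identityʳ (f i₀) ⟩
    f i₀                                    ∎
    where
    open ≡-Reasoning
    rest≡0 : ∑[ j < n ] f (Fin.punchIn i₀ j) ≡ +0
    rest≡0 = trans (sum-cong-≗ (λ j → f≡0 _ (Fin.punchInᵢ≢i i₀ j))) (sum-replicate-zero n)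

  ∑-sq-scaled-minus-sum : ∀ n (a : ℤ) (d : Fin n → ℤ) →
    ∑[ i < n ] sq (a * d i - sum d) ≡ a * a * ∑[ i < n ] sq (d i) - (+ 2 * a - + n) * sq (sum d)
  ∑-sq-scaled-minus-sum n a d = begin
    ∑[ i < n ] sq (a * d i - S)
      ≡⟨ sum-cong-≗ (λ i → expand a (d i) S) ⟩
    ∑[ i < n ] (a * a * sq (d i) + (c * d i + sq S))
      ≡⟨ ∑-distrib-+ (λ i → a * a * sq (d i)) _ ⟩
    ∑[ i < n ] (a * a * sq (d i)) + ∑[ i < n ] (c * d i + sq S)
      ≡⟨ cong₂ _+_ (sym (*-distribˡ-sum (a * a) (sq ∘ d))) (∑-distrib-+ (λ i → c * d i) _) ⟩
    a * a * Q + (∑[ i < n ] (c * d i) + ∑[ i < n ] sq S)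
      ≡⟨ cong₂ (λ u v → a * a * Q + (u + v)) (sym (*-distribˡ-sum c d)) (∑-const n (sq S)) ⟩
    a * a * Q + (c * S + + n * sq S)
      ≡⟨ collect a Q S (+ n) ⟩
    a * a * Q - (+ 2 * a - + n) * sq S ∎
    where
    open ≡-Reasoning
    S = sum d
    Q = ∑[ i < n ] sq (d i)
    c = - (+ 2 * a * S)
    expand : ∀ a x S → (a * x - S) * (a * x - S) ≡ a * a * (x * x) + (- (+ 2 * a * S) * x + S * S)
    expand = solve-∀
    collect : ∀ a Q S m → a * a * Q + (- (+ 2 * a * S) * S + m * (S * S)) ≡ a * a * Q - (+ 2 * a - m) * (S * S)
    collect = solve-∀

  private variable
    X X′ : Set

  ΣL : List X → (X → ℤ) → ℤ
  ΣL xs f = foldr (λ x s → f x + s) +0 xs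

  #_ : List X → ℤ
  # xs = + length xs

  ΣL-cong : ∀ (xs : List X) {f g : X → ℤ} → (∀ x → f x ≡ g x) → ΣL xs f ≡ ΣL xs g
  ΣL-cong []       f≗g = refl
  ΣL-cong (x ∷ xs) f≗g = cong₂ _+_ (f≗g x) (ΣL-cong xs f≗g)

  ΣL-++ : ∀ (xs ys : List X) (f : X → ℤ) → ΣL (xs ++ ys) f ≡ ΣL xs f + ΣL ys f
  ΣL-++ []       ys f = sym (ℤP.+-identityˡ _)
  ΣL-++ (x ∷ xs) ys f = trans (cong (λ s → f x + s) (ΣL-++ xs ys f)) (sym (ℤP.+-assoc (f x) _ _))

  ΣL-map : ∀ (g : X′ → X) (ys : List X′) (f : X → ℤ) → ΣL (map g ys) f ≡ ΣL ys (f ∘ g)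
  ΣL-map g []       f = refl
  ΣL-map g (y ∷ ys) f = cong (λ s → f (g y) + s) (ΣL-map g ys f)

  ΣL-concatMap : ∀ (g : X′ → List X) (ys : List X′) (f : X → ℤ) →
    ΣL (concatMap g ys) f ≡ ΣL ys (λ y → ΣL (g y) f)
  ΣL-concatMap g []       f = refl
  ΣL-concatMap g (y ∷ ys) f =
    trans (ΣL-++ (g y) (concatMap g ys) f) (cong (λ s → ΣL (g y) f + s) (ΣL-concatMap g ys f))

  ΣL-distrib-+ : ∀ (xs : List X) (f g : X → ℤ) → ΣL xs (λ x → f x + g x) ≡ ΣL xs f + ΣL xs g
  ΣL-distrib-+ []       f g = refl
  ΣL-distrib-+ (x ∷ xs) f g =
    trans (cong (λ s → f x + g x + s) (ΣL-distrib-+ xs f g)) (interchange (f x) (g x) _ _)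
    where
    interchange : ∀ a b c d → a + b + (c + d) ≡ a + c + (b + d)
    interchange = solve-∀

  *-distribˡ-ΣL : ∀ (xs : List X) (c : ℤ) (f : X → ℤ) → c * ΣL xs f ≡ ΣL xs (λ x → c * f x)
  *-distribˡ-ΣL []       c f = ℤP.*-zeroʳ c
  *-distribˡ-ΣL (x ∷ xs) c f =
    trans (ℤP.*-distribˡ-+ c (f x) _) (cong (λ s → c * f x + s) (*-distribˡ-ΣL xs c f))

  ΣL-neg : ∀ (xs : List X) (f : X → ℤ) → ΣL xs (λ x → - f x) ≡ - ΣL xs f
  ΣL-neg []       f = refl
  ΣL-neg (x ∷ xs) f =
    trans (cong (λ s → - f x + s) (ΣL-neg xs f)) (sym (ℤP.neg-distrib-+ (f x) _))

  ΣL-const : ∀ (xs : List X) (c : ℤ) → ΣL xs (λ _ → c) ≡ # xs * c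
  ΣL-const []       c = refl
  ΣL-const (x ∷ xs) c = trans (cong (λ s → c + s) (ΣL-const xs c)) (step c (# xs))
    where
    step : ∀ c m → c + m * c ≡ (+ 1 + m) * c
    step = solve-∀

  ΣL-comm : ∀ (xs : List X) (ys : List X′) (f : X → X′ → ℤ) →
    ΣL xs (λ x → ΣL ys (f x)) ≡ ΣL ys (λ y → ΣL xs (λ x → f x y))
  ΣL-comm []       ys f = sym (trans (ΣL-const ys +0) (ℤP.*-zeroʳ (# ys)))
  ΣL-comm (x ∷ xs) ys f =
    trans (cong (λ s → ΣL ys (f x) + s) (ΣL-comm xs ys f)) (sym (ΣL-distrib-+ ys (f x) _))

  Σ² : List X → (X → X → ℤ) → ℤ
  Σ² xs f = ΣL xs (λ a → ΣL xs (f a))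

  Σ²-cong : ∀ (xs : List X) {f g : X → X → ℤ} → (∀ a b → f a b ≡ g a b) → Σ² xs f ≡ Σ² xs g
  Σ²-cong xs f≗g = ΣL-cong xs (λ a → ΣL-cong xs (f≗g a))

  Σ²-distrib-+ : ∀ (xs : List X) (f g : X → X → ℤ) → Σ² xs (λ a b → f a b + g a b) ≡ Σ² xs f + Σ² xs g
  Σ²-distrib-+ xs f g =
    trans (ΣL-cong xs (λ a → ΣL-distrib-+ xs (f a) (g a))) (ΣL-distrib-+ xs (λ a → ΣL xs (f a)) _)

  *-distribˡ-Σ² : ∀ (xs : List X) (c : ℤ) (f : X → X → ℤ) → c * Σ² xs f ≡ Σ² xs (λ a b → c * f a b)
  *-distribˡ-Σ² xs c f =
    trans (*-distribˡ-ΣL xs c _) (ΣL-cong xs (λ a → *-distribˡ-ΣL xs c (f a)))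

  Σ²-const : ∀ (xs : List X) (c : ℤ) → Σ² xs (λ _ _ → c) ≡ sq (# xs) * c
  Σ²-const xs c = begin
    ΣL xs (λ _ → ΣL xs (λ _ → c)) ≡⟨ ΣL-cong xs (λ _ → ΣL-const xs c) ⟩
    ΣL xs (λ _ → # xs * c)        ≡⟨ ΣL-const xs (# xs * c) ⟩
    # xs * (# xs * c)             ≡⟨ ℤP.*-assoc (# xs) (# xs) c ⟨
    sq (# xs) * c                 ∎
    where open ≡-Reasoning

  Σ²-antisym : ∀ (xs : List X) (f : X → X → ℤ) → (∀ a b → f b a ≡ - f a b) → Σ² xs f ≡ +0
  Σ²-antisym xs f antisym = self-neg (begin
    Σ² xs f                         ≡⟨ ΣL-comm xs xs f ⟩
    Σ² xs (λ a b → f b a)           ≡⟨ Σ²-cong xs antisym ⟩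
    ΣL xs (λ a → ΣL xs (λ b → - f a b)) ≡⟨ ΣL-cong xs (λ a → ΣL-neg xs (f a)) ⟩
    ΣL xs (λ a → - ΣL xs (f a))     ≡⟨ ΣL-neg xs (λ a → ΣL xs (f a)) ⟩
    - Σ² xs f                       ∎)
    where
    open ≡-Reasoning
    self-neg : ∀ {i} → i ≡ - i → i ≡ +0
    self-neg {+ zero}   _  = refl
    self-neg {+ suc n}  ()
    self-neg { -[1+ n ]} ()

  -- Pair sums over the cube L^m

  sqDist diffSum : ∀ {m} → (Fin m → ℤ) → (Fin m → ℤ) → ℤ
  sqDist  {m} a b = ∑[ i < m ] sq (a i - b i)
  diffSum {m} a b = ∑[ i < m ] (a i - b i)

  spread : List ℤ → ℤ
  spread xs = Σ² xs (λ x y → sq (x - y))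

  spread≡ : ∀ xs → spread xs ≡ + 2 * # xs * ΣL xs sq - + 2 * sq (ΣL xs id)
  spread≡ xs = begin
    Σ² xs (λ x y → sq (x - y))
      ≡⟨ Σ²-cong xs (λ x y → expand x y) ⟩
    ΣL xs (λ x → ΣL xs (λ y → sq x + (- (+ 2 * x) * y + sq y)))
      ≡⟨ ΣL-cong xs (λ x → ΣL-distrib-+ xs (λ _ → sq x) _) ⟩
    ΣL xs (λ x → ΣL xs (λ _ → sq x) + ΣL xs (λ y → - (+ 2 * x) * y + sq y))
      ≡⟨ ΣL-cong xs (λ x → cong₂ _+_ (ΣL-const xs (sq x)) (ΣL-distrib-+ xs (λ y → - (+ 2 * x) * y) sq)) ⟩
    ΣL xs (λ x → # xs * sq x + (ΣL xs (λ y → - (+ 2 * x) * y) + Q))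
      ≡⟨ ΣL-cong xs (λ x → cong (λ s → # xs * sq x + (s + Q)) (sym (*-distribˡ-ΣL xs (- (+ 2 * x)) id))) ⟩
    ΣL xs (λ x → # xs * sq x + (- (+ 2 * x) * S + Q))
      ≡⟨ ΣL-cong xs (λ x → rearrange (# xs) x S Q) ⟩
    ΣL xs (λ x → (# xs * sq x + Q) + (- (+ 2 * S)) * x)
      ≡⟨ ΣL-distrib-+ xs (λ x → # xs * sq x + Q) _ ⟩
    ΣL xs (λ x → # xs * sq x + Q) + ΣL xs (λ x → - (+ 2 * S) * x)
      ≡⟨ cong₂ _+_ (ΣL-distrib-+ xs (λ x → # xs * sq x) (λ _ → Q)) (sym (*-distribˡ-ΣL xs (- (+ 2 * S)) id)) ⟩
    (ΣL xs (λ x → # xs * sq x) + ΣL xs (λ _ → Q)) + - (+ 2 * S) * S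
      ≡⟨ cong₂ (λ u v → (u + v) + - (+ 2 * S) * S) (sym (*-distribˡ-ΣL xs (# xs) sq)) (ΣL-const xs Q) ⟩
    (# xs * Q + # xs * Q) + - (+ 2 * S) * S
      ≡⟨ collect (# xs) Q S ⟩
    + 2 * # xs * Q - + 2 * sq S ∎
    where
    open ≡-Reasoning
    S = ΣL xs id
    Q = ΣL xs sq
    expand : ∀ x y → (x - y) * (x - y) ≡ x * x + (- (+ 2 * x) * y + y * y)
    expand = solve-∀
    rearrange : ∀ n x S Q → n * (x * x) + (- (+ 2 * x) * S + Q) ≡ (n * (x * x) + Q) + (- (+ 2 * S)) * x
    rearrange = solve-∀
    collect : ∀ n Q S → (n * Q + n * Q) + - (+ 2 * S) * S ≡ + 2 * n * Q - + 2 * (S * S)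
    collect = solve-∀

  module _ (p : ℕ) .{{_ : NonZero p}} where

    ΣL-box-suc : ∀ m (opts : Fin (suc m) → List ℤ) (G : ℤ → (Fin m → ℤ) → ℤ) →
      ΣL (box p (suc m) opts) (λ a → G (a zero) (a ∘ suc))
        ≡ ΣL (opts zero) (λ x → ΣL (box p m (opts ∘ suc)) (G x))
    ΣL-box-suc m opts G = trans (ΣL-concatMap _ (opts zero) G⁺)
      (ΣL-cong (opts zero) (λ x → ΣL-map _ (box p m (opts ∘ suc)) G⁺))
      where
      G⁺ : (Fin (suc m) → ℤ) → ℤ
      G⁺ a = G (a zero) (a ∘ suc)

    Σ²-box-suc : ∀ m (opts : Fin (suc m) → List ℤ) (H : ℤ → ℤ → (Fin m → ℤ) → (Fin m → ℤ) → ℤ) →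
      Σ² (box p (suc m) opts) (λ a b → H (a zero) (b zero) (a ∘ suc) (b ∘ suc))
        ≡ ΣL (opts zero) (λ x → ΣL (opts zero) (λ y → Σ² (box p m (opts ∘ suc)) (H x y)))
    Σ²-box-suc m opts H = begin
      ΣL R (λ a → ΣL R (λ b → H (a zero) (b zero) (a ∘ suc) (b ∘ suc)))
        ≡⟨ ΣL-cong R (λ a → ΣL-box-suc m opts (λ y b → H (a zero) y (a ∘ suc) b)) ⟩
      ΣL R (λ a → ΣL L (λ y → ΣL R′ (λ b → H (a zero) y (a ∘ suc) b)))
        ≡⟨ ΣL-box-suc m opts (λ x a → ΣL L (λ y → ΣL R′ (H x y a))) ⟩
      ΣL L (λ x → ΣL R′ (λ a → ΣL L (λ y → ΣL R′ (H x y a))))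
        ≡⟨ ΣL-cong L (λ x → ΣL-comm R′ L (λ a y → ΣL R′ (H x y a))) ⟩
      ΣL L (λ x → ΣL L (λ y → Σ² R′ (H x y))) ∎
      where
      open ≡-Reasoning
      R  = box p (suc m) opts
      R′ = box p m (opts ∘ suc)
      L  = opts zero

    cube : List ℤ → (m : ℕ) → List (Fin m → ℤ)
    cube L m = box p m (λ _ → L)

    #cube-suc : ∀ L m → # cube L (suc m) ≡ # L * # cube L m
    #cube-suc L m = begin
      # cube L (suc m)                       ≡⟨ count (cube L (suc m)) ⟩
      ΣL (cube L (suc m)) (λ _ → + 1)        ≡⟨ ΣL-box-suc m (λ _ → L) (λ _ _ → + 1) ⟩
      ΣL L (λ _ → ΣL (cube L m) (λ _ → + 1)) ≡⟨ ΣL-cong L (λ _ → count (cube L m)) ⟨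
      ΣL L (λ _ → # cube L m)                ≡⟨ ΣL-const L (# cube L m) ⟩
      # L * # cube L m                       ∎
      where
      open ≡-Reasoning
      count : ∀ (xs : List X) → # xs ≡ ΣL xs (λ _ → + 1)
      count xs = sym (trans (ΣL-const xs (+ 1)) (ℤP.*-identityʳ (# xs)))

    length-cube : ∀ L m → length (cube L m) ≡ length L ^ m
    length-cube L zero    = refl
    length-cube L (suc m) = ℤP.+-injective (begin
      # cube L (suc m)                   ≡⟨ #cube-suc L m ⟩
      # L * # cube L m                   ≡⟨ cong (λ n → # L * + n) (length-cube L m) ⟩
      + length L * + (length L ^ m)      ≡⟨ ℤP.pos-* (length L) (length L ^ m) ⟨
      + (length L ^ suc m)               ∎)
      where open ≡-Reasoning

    Σ²-sqDist-cube-suc : ∀ L m →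
      Σ² (cube L (suc m)) sqDist ≡ sq (# cube L m) * spread L + sq (# L) * Σ² (cube L m) sqDist
    Σ²-sqDist-cube-suc L m = begin
      Σ² (cube L (suc m)) sqDist
        ≡⟨ Σ²-box-suc m (λ _ → L) (λ x y a b → sq (x - y) + sqDist a b) ⟩
      ΣL L (λ x → ΣL L (λ y → Σ² C (λ a b → sq (x - y) + sqDist a b)))
        ≡⟨ Σ²-cong L (λ x y → trans (Σ²-distrib-+ C (λ _ _ → sq (x - y)) sqDist) (cong (_+ A) (Σ²-const C (sq (x - y))))) ⟩
      Σ² L (λ x y → sq (# C) * sq (x - y) + A)
        ≡⟨ Σ²-distrib-+ L (λ x y → sq (# C) * sq (x - y)) (λ _ _ → A) ⟩
      Σ² L (λ x y → sq (# C) * sq (x - y)) + Σ² L (λ _ _ → A)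
        ≡⟨ cong₂ _+_ (sym (*-distribˡ-Σ² L (sq (# C)) _)) (Σ²-const L A) ⟩
      sq (# C) * spread L + sq (# L) * A ∎
      where
      open ≡-Reasoning
      C = cube L m
      A = Σ² C sqDist

    Σ²-sqDist-cube : ∀ L m → Σ² (cube L (suc m)) sqDist ≡ + suc m * sq (# cube L m) * spread L
    Σ²-sqDist-cube L zero    = trans (Σ²-sqDist-cube-suc L zero) (base (spread L) (sq (# L)))
      where
      base : ∀ w l → + 1 * w + l * +0 ≡ + 1 * + 1 * w
      base = solve-∀
    Σ²-sqDist-cube L (suc m) = begin
      Σ² (cube L (2 ℕ.+ m)) sqDist
        ≡⟨ Σ²-sqDist-cube-suc L (suc m) ⟩
      sq (# cube L (suc m)) * spread L + sq (# L) * Σ² (cube L (suc m)) sqDist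
        ≡⟨ cong₂ (λ c A → sq c * spread L + sq (# L) * A) (#cube-suc L m) (Σ²-sqDist-cube L m) ⟩
      sq (# L * # cube L m) * spread L + sq (# L) * (+ suc m * sq (# cube L m) * spread L)
        ≡⟨ collect (# L) (# cube L m) (+ suc m) (spread L) ⟩
      (+ 1 + + suc m) * sq (# L * # cube L m) * spread L
        ≡⟨ cong (λ c → + (2 ℕ.+ m) * sq c * spread L) (#cube-suc L m) ⟨
      + (2 ℕ.+ m) * sq (# cube L (suc m)) * spread L ∎
      where
      open ≡-Reasoning
      collect : ∀ l c k w → (l * c) * (l * c) * w + l * l * (k * (c * c) * w) ≡ (+ 1 + k) * ((l * c) * (l * c)) * w
      collect = solve-∀

    -- The cross terms (a i - b i) (a j - b j), i ≢ j, cancel: after summing over the other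
    -- coordinates, what remains of the first coordinates x, y is antisymmetric in (x, y).
    Σ²-cube-[sq-diffSum-sqDist]≡0 : ∀ L m → Σ² (cube L m) (λ a b → sq (diffSum a b) - sqDist a b) ≡ +0
    Σ²-cube-[sq-diffSum-sqDist]≡0 L zero    = refl
    Σ²-cube-[sq-diffSum-sqDist]≡0 L (suc m) = begin
      Σ² (cube L (suc m)) (λ a b → sq (diffSum a b) - sqDist a b)
        ≡⟨ Σ²-box-suc m (λ _ → L) (λ x y a b → sq ((x - y) + diffSum a b) - (sq (x - y) + sqDist a b)) ⟩
      ΣL L (λ x → ΣL L (λ y → Σ² C (λ a b → sq ((x - y) + diffSum a b) - (sq (x - y) + sqDist a b))))
        ≡⟨ Σ²-cong L (λ x y → cross-term (x - y)) ⟩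
      Σ² L (λ x y → + 2 * Σ² C diffSum * (x - y))
        ≡⟨ Σ²-antisym L _ (λ x y → antisym (+ 2 * Σ² C diffSum) x y) ⟩
      +0 ∎
      where
      open ≡-Reasoning
      C = cube L m
      cross-term : ∀ d → Σ² C (λ a b → sq (d + diffSum a b) - (sq d + sqDist a b)) ≡ + 2 * Σ² C diffSum * d
      cross-term d = begin
        Σ² C (λ a b → sq (d + diffSum a b) - (sq d + sqDist a b))
          ≡⟨ Σ²-cong C (λ a b → expand d (diffSum a b) (sqDist a b)) ⟩
        Σ² C (λ a b → (sq (diffSum a b) - sqDist a b) + + 2 * d * diffSum a b)
          ≡⟨ Σ²-distrib-+ C (λ a b → sq (diffSum a b) - sqDist a b) (λ a b → + 2 * d * diffSum a b) ⟩
        Σ² C (λ a b → sq (diffSum a b) - sqDist a b) + Σ² C (λ a b → + 2 * d * diffSum a b)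
          ≡⟨ cong₂ _+_ (Σ²-cube-[sq-diffSum-sqDist]≡0 L m) (sym (*-distribˡ-Σ² C (+ 2 * d) diffSum)) ⟩
        +0 + + 2 * d * Σ² C diffSum
          ≡⟨ swap d (Σ² C diffSum) ⟩
        + 2 * Σ² C diffSum * d ∎
        where
        expand : ∀ d s q → (d + s) * (d + s) - (d * d + q) ≡ (s * s - q) + + 2 * d * s
        expand = solve-∀
        swap : ∀ d z → +0 + + 2 * d * z ≡ + 2 * z * d
        swap = solve-∀
      antisym : ∀ c x y → c * (y - x) ≡ - (c * (x - y))
      antisym = solve-∀

  -- Sums over the interval [-N, N]

  ΣL-applyUpTo : ∀ (g : ℕ → X) m (h : X → ℤ) → ΣL (applyUpTo g m) h ≡ ∑[ i < m ] h (g (toℕ i))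
  ΣL-applyUpTo g zero    h = refl
  ΣL-applyUpTo g (suc m) h = cong (λ s → h (g 0) + s) (ΣL-applyUpTo (g ∘ suc) m h)

  ∑-consecutive : ∀ m z → + 2 * ∑[ i < m ] (+ toℕ i + z) ≡ + m * (+ 2 * z + + m - + 1)
  ∑-consecutive zero    z = refl
  ∑-consecutive (suc m) z = begin
    + 2 * (+0 + z + ∑[ i < m ] (+ suc (toℕ i) + z))
      ≡⟨ cong (λ s → + 2 * (+0 + z + s)) (sum-cong-≗ {m} (λ i → shift (+ toℕ i) z)) ⟩
    + 2 * (+0 + z + ∑[ i < m ] (+ toℕ i + (z + + 1)))
      ≡⟨ ℤP.*-distribˡ-+ (+ 2) (+0 + z) _ ⟩
    + 2 * (+0 + z) + + 2 * ∑[ i < m ] (+ toℕ i + (z + + 1))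
      ≡⟨ cong (λ s → + 2 * (+0 + z) + s) (∑-consecutive m (z + + 1)) ⟩
    + 2 * (+0 + z) + + m * (+ 2 * (z + + 1) + + m - + 1)
      ≡⟨ collect z (+ m) ⟩
    (+ 1 + + m) * (+ 2 * z + (+ 1 + + m) - + 1) ∎
    where
    open ≡-Reasoning
    shift : ∀ i z → (+ 1 + i) + z ≡ i + (z + + 1)
    shift = solve-∀
    collect : ∀ z m → + 2 * (+0 + z) + m * (+ 2 * (z + + 1) + m - + 1) ≡ (+ 1 + m) * (+ 2 * z + (+ 1 + m) - + 1)
    collect = solve-∀

  ∑-consecutive-sq : ∀ m z → + 6 * ∑[ i < m ] sq (+ toℕ i + z)
    ≡ + m * (+ 6 * sq z + + 6 * z * (+ m - + 1) + (+ m - + 1) * (+ 2 * + m - + 1))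
  ∑-consecutive-sq zero    z = refl
  ∑-consecutive-sq (suc m) z = begin
    + 6 * (sq (+0 + z) + ∑[ i < m ] sq (+ suc (toℕ i) + z))
      ≡⟨ cong (λ s → + 6 * (sq (+0 + z) + s)) (sum-cong-≗ {m} (λ i → cong sq (shift (+ toℕ i) z))) ⟩
    + 6 * (sq (+0 + z) + ∑[ i < m ] sq (+ toℕ i + (z + + 1)))
      ≡⟨ ℤP.*-distribˡ-+ (+ 6) (sq (+0 + z)) _ ⟩
    + 6 * sq (+0 + z) + + 6 * ∑[ i < m ] sq (+ toℕ i + (z + + 1))
      ≡⟨ cong (λ s → + 6 * sq (+0 + z) + s) (∑-consecutive-sq m (z + + 1)) ⟩
    + 6 * sq (+0 + z) + + m * (+ 6 * sq (z + + 1) + + 6 * (z + + 1) * (+ m - + 1) + (+ m - + 1) * (+ 2 * + m - + 1))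
      ≡⟨ collect z (+ m) ⟩
    (+ 1 + + m) * (+ 6 * sq z + + 6 * z * ((+ 1 + + m) - + 1) + ((+ 1 + + m) - + 1) * (+ 2 * (+ 1 + + m) - + 1)) ∎
    where
    open ≡-Reasoning
    shift : ∀ i z → (+ 1 + i) + z ≡ i + (z + + 1)
    shift = solve-∀
    collect : ∀ z m →
      + 6 * ((+0 + z) * (+0 + z)) + m * (+ 6 * ((z + + 1) * (z + + 1)) + + 6 * (z + + 1) * (m - + 1) + (m - + 1) * (+ 2 * m - + 1))
        ≡ (+ 1 + m) * (+ 6 * (z * z) + + 6 * z * ((+ 1 + m) - + 1) + ((+ 1 + m) - + 1) * (+ 2 * (+ 1 + m) - + 1))
    collect = solve-∀

  +[1+2N] : ∀ N → + suc (2 ℕ.* N) ≡ + 1 + + 2 * + N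
  +[1+2N] N = cong (λ n → + 1 + n) (ℤP.pos-* 2 N)

  module _ (p : ℕ) .{{_ : NonZero p}} (N : ℕ) where

    #range : # range p N ≡ + suc (2 ℕ.* N)
    #range = cong +_ (trans (List.length-map _ (upTo (suc (2 ℕ.* N)))) (List.length-upTo (suc (2 ℕ.* N))))

    ΣL-range : ∀ f → ΣL (range p N) f ≡ ∑[ i < suc (2 ℕ.* N) ] f (+ toℕ i - + N)
    ΣL-range f = trans (ΣL-map _ (upTo (suc (2 ℕ.* N))) f) (ΣL-applyUpTo id (suc (2 ℕ.* N)) (f ∘ λ i → + i - + N))

    ΣL-range-id : ΣL (range p N) id ≡ +0
    ΣL-range-id = ℤP.*-cancelˡ-≡ (+ 2) _ +0 (begin
      + 2 * ΣL (range p N) id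
        ≡⟨ cong (+ 2 *_) (ΣL-range id) ⟩
      + 2 * ∑[ i < suc (2 ℕ.* N) ] (+ toℕ i - + N)
        ≡⟨ ∑-consecutive (suc (2 ℕ.* N)) (- + N) ⟩
      + suc (2 ℕ.* N) * (+ 2 * - + N + + suc (2 ℕ.* N) - + 1)
        ≡⟨ cong (λ m → m * (+ 2 * - + N + m - + 1)) (+[1+2N] N) ⟩
      (+ 1 + + 2 * + N) * (+ 2 * - + N + (+ 1 + + 2 * + N) - + 1)
        ≡⟨ vanish (+ N) ⟩
      + 2 * +0 ∎)
      where
      open ≡-Reasoning
      vanish : ∀ n → (+ 1 + + 2 * n) * (+ 2 * - n + (+ 1 + + 2 * n) - + 1) ≡ + 2 * +0
      vanish = solve-∀

    ΣL-range-sq : + 3 * ΣL (range p N) sq ≡ + suc (2 ℕ.* N) * (+ N * (+ N + + 1))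
    ΣL-range-sq = ℤP.*-cancelˡ-≡ (+ 2) _ _ (begin
      + 2 * (+ 3 * ΣL (range p N) sq)
        ≡⟨ ℤP.*-assoc (+ 2) (+ 3) _ ⟨
      + 6 * ΣL (range p N) sq
        ≡⟨ cong (+ 6 *_) (ΣL-range sq) ⟩
      + 6 * ∑[ i < suc (2 ℕ.* N) ] sq (+ toℕ i - + N)
        ≡⟨ ∑-consecutive-sq (suc (2 ℕ.* N)) (- + N) ⟩
      m * (+ 6 * sq (- + N) + + 6 * - + N * (m - + 1) + (m - + 1) * (+ 2 * m - + 1))
        ≡⟨ cong (λ m → m * (+ 6 * sq (- + N) + + 6 * - + N * (m - + 1) + (m - + 1) * (+ 2 * m - + 1))) (+[1+2N] N) ⟩
      m′ * (+ 6 * sq (- + N) + + 6 * - + N * (m′ - + 1) + (m′ - + 1) * (+ 2 * m′ - + 1))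
        ≡⟨ evaluate (+ N) ⟩
      + 2 * ((+ 1 + + 2 * + N) * (+ N * (+ N + + 1)))
        ≡⟨ cong (λ m → + 2 * (m * (+ N * (+ N + + 1)))) (+[1+2N] N) ⟨
      + 2 * (m * (+ N * (+ N + + 1))) ∎)
      where
      open ≡-Reasoning
      m = + suc (2 ℕ.* N)
      m′ = + 1 + + 2 * + N
      evaluate : ∀ n → let m = + 1 + + 2 * n in
        m * (+ 6 * (- n * - n) + + 6 * - n * (m - + 1) + (m - + 1) * (+ 2 * m - + 1)) ≡ + 2 * (m * (n * (n + + 1)))
      evaluate = solve-∀

    spread-range : + 3 * spread (range p N) ≡ + 2 * sq (# range p N) * (+ N * (+ N + + 1))
    spread-range = begin
      + 3 * spread L
        ≡⟨ cong (+ 3 *_) (spread≡ L) ⟩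
      + 3 * (+ 2 * # L * ΣL L sq - + 2 * sq (ΣL L id))
        ≡⟨ cong (λ s → + 3 * (+ 2 * # L * ΣL L sq - + 2 * sq s)) ΣL-range-id ⟩
      + 3 * (+ 2 * # L * ΣL L sq - + 2 * sq +0)
        ≡⟨ regroup (# L) (ΣL L sq) ⟩
      + 2 * # L * (+ 3 * ΣL L sq)
        ≡⟨ cong (λ s → + 2 * # L * s) (trans ΣL-range-sq (cong (_* (+ N * (+ N + + 1))) (sym #range))) ⟩
      + 2 * # L * (# L * (+ N * (+ N + + 1)))
        ≡⟨ regroup′ (# L) (+ N * (+ N + + 1)) ⟩
      + 2 * sq (# L) * (+ N * (+ N + + 1)) ∎
      where
      open ≡-Reasoning
      L = range p N
      regroup : ∀ l q → + 3 * (+ 2 * l * q - + 2 * (+0 * +0)) ≡ + 2 * l * (+ 3 * q)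
      regroup = solve-∀
      regroup′ : ∀ l k → + 2 * l * (l * k) ≡ + 2 * (l * l) * k
      regroup′ = solve-∀

  -- Arithmetic modulo a prime

  injective⇒surjective : ∀ {n} (f : Fin n → Fin n) → (∀ {i j} → f i ≡ f j → i ≡ j) → ∀ y → ∃ λ x → f x ≡ y
  injective⇒surjective {suc n} f f-inj y with Fin.any? (λ x → f x Fin.≟ y)
  ... | yes found = found
  ... | no ∄x = collision (Fin.pigeonhole (ℕP.n<1+n n) (λ x → punchOut (miss x)))
    where
    miss : ∀ x → y ≢ f x
    miss x y≡fx = ∄x (x , sym y≡fx)
    collision : (∃₂ λ i j → i Fin.< j × punchOut (miss i) ≡ punchOut (miss j)) → ∃ λ x → f x ≡ y
    collision (i , j , i<j , gi≡gj) =
      contradiction (f-inj (Fin.punchOut-injective (miss i) (miss j) gi≡gj)) (ℕP.<⇒≢ i<j ∘ cong toℕ)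

  module _ {P : ℕ} .{{_ : NonZero P}} where

    <∧∣⇒≡0 : ∀ {d} → d ℕ.< P → P ∣ d → d ≡ 0
    <∧∣⇒≡0 {zero}  _   _   = refl
    <∧∣⇒≡0 {suc d} d<P P∣d = contradiction P∣d (>⇒∤ d<P)

    %-≡⇒∣∸ : ∀ x y → x % P ≡ y % P → P ∣ y ∸ x
    %-≡⇒∣∸ x y eq = divides (y / P ∸ x / P) (begin
      y ∸ x                                         ≡⟨ cong₂ _∸_ (m≡m%n+[m/n]*n y P) (m≡m%n+[m/n]*n x P) ⟩
      (y % P ℕ.+ y / P ℕ.* P) ∸ (x % P ℕ.+ x / P ℕ.* P)
        ≡⟨ cong (λ r → (y % P ℕ.+ y / P ℕ.* P) ∸ (r ℕ.+ x / P ℕ.* P)) eq ⟩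
      (y % P ℕ.+ y / P ℕ.* P) ∸ (y % P ℕ.+ x / P ℕ.* P) ≡⟨ ℕP.[m+n]∸[m+o]≡n∸o (y % P) _ _ ⟩
      y / P ℕ.* P ∸ x / P ℕ.* P                       ≡⟨ ℕP.*-distribʳ-∸ P (y / P) (x / P) ⟨
      (y / P ∸ x / P) ℕ.* P                           ∎)
      where open ≡-Reasoning

    ∣∸⇒≡ : ∀ {a b} → a ℕ.< P → b ℕ.< P → P ∣ b ∸ a → P ∣ a ∸ b → a ≡ b
    ∣∸⇒≡ {a} {b} a<P b<P P∣b∸a P∣a∸b = ℕP.≤-antisym
      (ℕP.m∸n≡0⇒m≤n (<∧∣⇒≡0 (ℕP.≤-<-trans (ℕP.m∸n≤m a b) a<P) P∣a∸b))
      (ℕP.m∸n≡0⇒m≤n (<∧∣⇒≡0 (ℕP.≤-<-trans (ℕP.m∸n≤m b a) b<P) P∣b∸a))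

    +-%-cancelʳ : ∀ {a b} j → a ℕ.< P → b ℕ.< P → (a ℕ.+ j) % P ≡ (b ℕ.+ j) % P → a ≡ b
    +-%-cancelʳ {a} {b} j a<P b<P eq =
      ∣∸⇒≡ a<P b<P (∣-shift a b (%-≡⇒∣∸ _ _ eq)) (∣-shift b a (%-≡⇒∣∸ _ _ (sym eq)))
      where
      ∣-shift : ∀ u v → P ∣ (v ℕ.+ j) ∸ (u ℕ.+ j) → P ∣ v ∸ u
      ∣-shift u v = subst (P ∣_)
        (trans (cong₂ _∸_ (ℕP.+-comm v j) (ℕP.+-comm u j)) (ℕP.[m+n]∸[m+o]≡n∸o j v u))

  module _ {P : ℕ} (P-prime : Prime P) where

    private instance
      _ = prime⇒nonZero P-prime

    *-%-cancelˡ : ∀ {m a b} → 0 ℕ.< m → m ℕ.< P → a ℕ.< P → b ℕ.< P → (m ℕ.* a) % P ≡ (m ℕ.* b) % P → a ≡ b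
    *-%-cancelˡ {m} {a} {b} 0<m m<P a<P b<P eq =
      ∣∸⇒≡ a<P b<P (∣-cancel a b (%-≡⇒∣∸ _ _ eq)) (∣-cancel b a (%-≡⇒∣∸ _ _ (sym eq)))
      where
      ∣-cancel : ∀ u v → P ∣ m ℕ.* v ∸ m ℕ.* u → P ∣ v ∸ u
      ∣-cancel u v P∣ with euclidsLemma m (v ∸ u) P-prime (subst (P ∣_) (sym (ℕP.*-distribˡ-∸ m v u)) P∣)
      ... | inj₁ P∣m   = contradiction (<∧∣⇒≡0 m<P P∣m) (ℕP.>⇒≢ 0<m)
      ... | inj₂ P∣v∸u = P∣v∸u

    *-%-≢0 : ∀ {a b} → 0 ℕ.< a → a ℕ.< P → 0 ℕ.< b → b ℕ.< P → (a ℕ.* b) % P ≢ 0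
    *-%-≢0 {a} {b} 0<a a<P 0<b b<P ab%P≡0 with euclidsLemma a b P-prime (m%n≡0⇒n∣m (a ℕ.* b) P ab%P≡0)
    ... | inj₁ P∣a = ℕP.>⇒≢ 0<a (<∧∣⇒≡0 a<P P∣a)
    ... | inj₂ P∣b = ℕP.>⇒≢ 0<b (<∧∣⇒≡0 b<P P∣b)

  -- The trace in coefficients

  if-≡ᵇ-≡ : ∀ {a b} (x : ℤ) → a ≡ b → (if a ℕ.≡ᵇ b then x else +0) ≡ x
  if-≡ᵇ-≡ {a} {b} x a≡b with a ℕ.≡ᵇ b | ℕP.≡⇒≡ᵇ a b a≡b
  ... | true | _ = refl

  if-≡ᵇ-≢ : ∀ {a b} (x : ℤ) → a ≢ b → (if a ℕ.≡ᵇ b then x else +0) ≡ +0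
  if-≡ᵇ-≢ {a} {b} x a≢b with a ℕ.≡ᵇ b in eq
  ... | true  = contradiction (ℕP.≡ᵇ⇒≡ a b (subst T (sym eq) _)) a≢b
  ... | false = refl

  module _ (p : ℕ) .{{_ : NonZero p}} where

    toℕ-idx : ∀ a → toℕ (idx p a) ≡ a % p
    toℕ-idx a = Fin.toℕ-fromℕ< _

    push-coefficient : ∀ g c (k : Fin p) → push p g c k ≡ ∑[ m < p ] (if toℕ (g m) ℕ.≡ᵇ toℕ k then c m else +0)
    push-coefficient g c k = ΣFin≡sum p _

    σ-coefficient : ∀ j c (k : Fin p) →
      σ p j c k ≡ ∑[ m < p ] (if toℕ (idx p (toℕ m ℕ.* j)) ℕ.≡ᵇ toℕ k then c m else +0)
    σ-coefficient j = push-coefficient (λ m → idx p (toℕ m ℕ.* j))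

    mulω-coefficient : ∀ j c (k : Fin p) →
      mulω p j c k ≡ ∑[ m < p ] (if toℕ (idx p (toℕ m ℕ.+ j)) ℕ.≡ᵇ toℕ k then c m else +0)
    mulω-coefficient j = push-coefficient (λ m → idx p (toℕ m ℕ.+ j))

    sum-push : ∀ g c → sum (push p g c) ≡ sum c
    sum-push g c = begin
      ∑[ k < p ] push p g c k
        ≡⟨ sum-cong-≗ {p} (push-coefficient g c) ⟩
      ∑[ k < p ] ∑[ m < p ] (if toℕ (g m) ℕ.≡ᵇ toℕ k then c m else +0)
        ≡⟨ ∑-comm {p} {p} (λ k m → if toℕ (g m) ℕ.≡ᵇ toℕ k then c m else +0) ⟩
      ∑[ m < p ] ∑[ k < p ] (if toℕ (g m) ℕ.≡ᵇ toℕ k then c m else +0)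
        ≡⟨ sum-cong-≗ {p} (λ m → trans (∑-single _ (g m) (λ k k≢gm → if-≡ᵇ-≢ (c m) (k≢gm ∘ sym ∘ Fin.toℕ-injective)))
                                        (if-≡ᵇ-≡ {toℕ (g m)} (c m) refl)) ⟩
      ∑[ m < p ] c m ∎
      where open ≡-Reasoning

    TrE-coefficient : ∀ c k → TrE p c k ≡ ∑[ i < p ∸ 1 ] σ p (suc (toℕ i)) c k
    TrE-coefficient c k = begin
      TrE p c k                                    ≡⟨ at k (map suc (upTo (p ∸ 1))) ⟩
      ΣL (map suc (upTo (p ∸ 1))) (λ j → σ p j c k) ≡⟨ ΣL-map suc (upTo (p ∸ 1)) (λ j → σ p j c k) ⟩
      ΣL (upTo (p ∸ 1)) (λ j → σ p (suc j) c k)    ≡⟨ ΣL-applyUpTo id (p ∸ 1) (λ j → σ p (suc j) c k) ⟩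
      ∑[ i < p ∸ 1 ] σ p (suc (toℕ i)) c k          ∎
      where
      open ≡-Reasoning
      at : ∀ k js → foldr (λ j s → _⊕_ p (σ p j c) s) (zeroE p) js k ≡ ΣL js (λ j → σ p j c k)
      at k []       = refl
      at k (j ∷ js) = cong (λ s → σ p j c k + s) (at k js)

  -- p = 2 + k, so that idx p 1, which ratPart reads, computes to suc zero.
  module Trace (k : ℕ) (P-prime : Prime (2 ℕ.+ k)) where

    P n : ℕ
    P = 2 ℕ.+ k
    n = 1 ℕ.+ k

    σ-at-zero : ∀ (i : Fin n) c → σ P (suc (toℕ i)) c zero ≡ c zero
    σ-at-zero i c = trans (σ-coefficient P (suc (toℕ i)) c zero) (∑-single _ zero vanish)
      where
      vanish : ∀ m → m ≢ zero → (if toℕ (idx P (toℕ m ℕ.* suc (toℕ i))) ℕ.≡ᵇ 0 then c m else +0) ≡ +0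
      vanish zero    m≢0 = contradiction refl m≢0
      vanish (suc m) _   = if-≡ᵇ-≢ (c (suc m))
        (*-%-≢0 P-prime (s≤s z≤n) (Fin.toℕ<n (suc m)) (s≤s z≤n) (s≤s (Fin.toℕ<n i))
          ∘ trans (sym (toℕ-idx P (suc (toℕ m) ℕ.* suc (toℕ i)))))

    TrE-at-zero : ∀ c → TrE P c zero ≡ + n * c zero
    TrE-at-zero c = begin
      TrE P c zero                             ≡⟨ TrE-coefficient P c zero ⟩
      ∑[ i < n ] σ P (suc (toℕ i)) c zero       ≡⟨ sum-cong-≗ {n} (λ i → σ-at-zero i c) ⟩
      ∑[ i < n ] c zero                        ≡⟨ ∑-const n (c zero) ⟩
      + n * c zero                             ∎
      where open ≡-Reasoning

    inverse : ∀ (m : Fin n) → ∃ λ (i₀ : Fin n) → toℕ (idx P (suc (toℕ m) ℕ.* suc (toℕ i₀))) ≡ 1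
    inverse m with injective⇒surjective scale scale-injective (suc zero)
      where
      scale : Fin P → Fin P
      scale a = idx P (suc (toℕ m) ℕ.* toℕ a)
      scale-injective : ∀ {a b} → scale a ≡ scale b → a ≡ b
      scale-injective {a} {b} eq = Fin.toℕ-injective (*-%-cancelˡ P-prime (s≤s z≤n) (Fin.toℕ<n (suc m))
        (Fin.toℕ<n a) (Fin.toℕ<n b)
        (trans (sym (toℕ-idx P (suc (toℕ m) ℕ.* toℕ a))) (trans (cong toℕ eq) (toℕ-idx P (suc (toℕ m) ℕ.* toℕ b)))))
    ... | zero   , scale0≡1 = contradiction
      (trans (sym (cong toℕ scale0≡1)) (trans (toℕ-idx P (suc (toℕ m) ℕ.* 0)) (cong (_% P) (ℕP.*-zeroʳ (suc (toℕ m)))))) (λ ())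
    ... | suc i₀ , scale[1+i₀]≡1 = i₀ , cong toℕ scale[1+i₀]≡1

    ∑-inverse : ∀ (m : Fin n) (x : ℤ) →
      ∑[ i < n ] (if toℕ (idx P (suc (toℕ m) ℕ.* suc (toℕ i))) ℕ.≡ᵇ 1 then x else +0) ≡ x
    ∑-inverse m x with inverse m
    ... | i₀ , i₀-inverse = trans (∑-single _ i₀ other) (if-≡ᵇ-≡ x i₀-inverse)
      where
      other : ∀ i → i ≢ i₀ → (if toℕ (idx P (suc (toℕ m) ℕ.* suc (toℕ i))) ℕ.≡ᵇ 1 then x else +0) ≡ +0
      other i i≢i₀ = if-≡ᵇ-≢ x (λ i-inverse → i≢i₀ (Fin.toℕ-injective (ℕP.suc-injective
        (*-%-cancelˡ P-prime (s≤s z≤n) (Fin.toℕ<n (suc m)) (Fin.toℕ<n (suc i)) (Fin.toℕ<n (suc i₀))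
          (trans (sym (toℕ-idx P (suc (toℕ m) ℕ.* suc (toℕ i))))
            (trans i-inverse (trans (sym i₀-inverse) (toℕ-idx P (suc (toℕ m) ℕ.* suc (toℕ i₀))))))))))

    TrE-at-one : ∀ c → TrE P c (suc zero) ≡ ∑[ m < n ] c (suc m)
    TrE-at-one c = begin
      TrE P c (suc zero)
        ≡⟨ TrE-coefficient P c (suc zero) ⟩
      ∑[ i < n ] σ P (suc (toℕ i)) c (suc zero)
        ≡⟨ sum-cong-≗ {n} (λ i → σ-coefficient P (suc (toℕ i)) c (suc zero)) ⟩
      ∑[ i < n ] ∑[ m < P ] δ i m
        ≡⟨ ∑-comm {n} {P} δ ⟩
      ∑[ i < n ] δ i zero + ∑[ m < n ] ∑[ i < n ] δ i (suc m)
        ≡⟨ cong₂ _+_ (sum-replicate-zero n) (sum-cong-≗ {n} (λ m → ∑-inverse m (c (suc m)))) ⟩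
      +0 + ∑[ m < n ] c (suc m)
        ≡⟨ ℤP.+-identityˡ _ ⟩
      ∑[ m < n ] c (suc m) ∎
      where
      open ≡-Reasoning
      δ : Fin n → Fin P → ℤ
      δ i m = if toℕ (idx P (toℕ m ℕ.* suc (toℕ i))) ℕ.≡ᵇ 1 then c m else +0

    Tr-coefficients : ∀ c → Tr P c ≡ + P * c zero - sum c
    Tr-coefficients c = trans (cong₂ _-_ (TrE-at-zero c) (TrE-at-one c)) (rearrange (+ n) (c zero) _)
      where
      rearrange : ∀ m x s → m * x - s ≡ (+ 1 + m) * x - (x + s)
      rearrange = solve-∀

    mulω-at-zero : ∀ j → 0 ℕ.< j → j ℕ.< P → ∀ γ → mulω P j γ zero ≡ γ (idx P (P ∸ j))
    mulω-at-zero j 0<j j<P γ =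
      trans (mulω-coefficient P j γ zero)
        (trans (∑-single _ m₀ other) (if-≡ᵇ-≡ (γ m₀) (trans (toℕ-idx P (toℕ m₀ ℕ.+ j)) m₀+j≡0)))
      where
      m₀ = idx P (P ∸ j)
      m₀+j≡0 : (toℕ m₀ ℕ.+ j) % P ≡ 0
      m₀+j≡0 = begin
        (toℕ m₀ ℕ.+ j) % P
          ≡⟨ cong (λ t → (t ℕ.+ j) % P) (trans (toℕ-idx P (P ∸ j)) (m<n⇒m%n≡m (ℕP.∸-monoʳ-< 0<j (ℕP.<⇒≤ j<P)))) ⟩
        (P ∸ j ℕ.+ j) % P  ≡⟨ cong (_% P) (ℕP.m∸n+n≡m (ℕP.<⇒≤ j<P)) ⟩
        P % P              ≡⟨ n%n≡0 P ⟩
        0                  ∎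
        where open ≡-Reasoning
      other : ∀ m → m ≢ m₀ → (if toℕ (idx P (toℕ m ℕ.+ j)) ℕ.≡ᵇ 0 then γ m else +0) ≡ +0
      other m m≢m₀ = if-≡ᵇ-≢ (γ m) (λ m+j≡0 → m≢m₀ (Fin.toℕ-injective
        (+-%-cancelʳ j (Fin.toℕ<n m) (Fin.toℕ<n m₀) (trans (sym (toℕ-idx P (toℕ m ℕ.+ j))) (trans m+j≡0 (sym m₀+j≡0))))))

    Tr-mulω : ∀ j → 0 ℕ.< j → j ℕ.< P → ∀ γ → Tr P (mulω P j γ) ≡ + P * γ (idx P (P ∸ j)) - sum γ
    Tr-mulω j 0<j j<P γ = trans (Tr-coefficients (mulω P j γ))
      (cong₂ (λ a b → + P * a - b) (mulω-at-zero j 0<j j<P γ) (sum-push P (λ m → idx P (toℕ m ℕ.+ j)) γ))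

    idx-reflect : ∀ (i : Fin n) → idx P (P ∸ suc (toℕ i)) ≡ suc (opposite i)
    idx-reflect i = Fin.toℕ-injective (begin
      toℕ (idx P (n ∸ toℕ i))   ≡⟨ toℕ-idx P (n ∸ toℕ i) ⟩
      (n ∸ toℕ i) % P           ≡⟨ m<n⇒m%n≡m (s≤s (ℕP.m∸n≤m n (toℕ i))) ⟩
      n ∸ toℕ i                 ≡⟨ ℕP.+-∸-assoc 1 (Fin.toℕ<n i) ⟩
      suc (n ∸ suc (toℕ i))     ≡⟨ cong suc (Fin.opposite-prop i) ⟨
      suc (toℕ (opposite i))    ∎)
      where open ≡-Reasoning

    -- Tr (ω^j γ) reads γ at p - j; reversing the sum undoes the reflection j ↦ p - j.
    norm²-coefficients : ∀ γ → norm² P γ ≡ ∑[ i < n ] sq (+ P * γ (suc i) - sum γ)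
    norm²-coefficients γ = begin
      norm² P γ
        ≡⟨ ΣL-applyUpTo id n (λ j → sq (Tr P (mulω P (suc j) γ))) ⟩
      ∑[ i < n ] sq (Tr P (mulω P (suc (toℕ i)) γ))
        ≡⟨ sum-cong-≗ {n} (λ i → cong sq (Tr-mulω (suc (toℕ i)) (s≤s z≤n) (s≤s (Fin.toℕ<n i)) γ)) ⟩
      ∑[ i < n ] F (idx P (P ∸ suc (toℕ i)))
        ≡⟨ sum-cong-≗ {n} (λ i → cong F (idx-reflect i)) ⟩
      ∑[ i < n ] F (suc (opposite i))
        ≡⟨ ∑-permute (F ∘ suc) Perm.reverse ⟨
      ∑[ i < n ] F (suc i) ∎
      where
      open ≡-Reasoning
      F : Fin P → ℤ
      F m = sq (+ P * γ m - sum γ)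

  -- The second moment

  module Moment (k : ℕ) (P-prime : Prime (2 ℕ.+ k)) (N : ℕ) where

    open Trace k P-prime using (P; n; norm²-coefficients)

    L : List ℤ
    L = range P N

    -- dist² p (x ∷ a) (y ∷ b) in the form given by norm²-coefficients
    Ψ : ℤ → ℤ → (Fin n → ℤ) → (Fin n → ℤ) → ℤ
    Ψ x y a b = ∑[ i < n ] sq (+ P * (a i - b i) - ((x - y) + diffSum a b))

    Σ²-dist²-cube : Σ² (B P N) (dist² P) ≡ Σ² (cube P L n) (Ψ +0 +0)
    Σ²-dist²-cube = begin
      Σ² (B P N) (dist² P)
        ≡⟨ Σ²-cong (B P N) (λ α β → norm²-coefficients (_⊖_ P α β)) ⟩
      Σ² (B P N) (λ α β → Ψ (α zero) (β zero) (α ∘ suc) (β ∘ suc))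
        ≡⟨ Σ²-box-suc P n (λ i → if toℕ i ℕ.≡ᵇ 0 then +0 ∷ [] else L) Ψ ⟩
      Σ² (cube P L n) (Ψ +0 +0) + +0 + +0
        ≡⟨ trans (ℤP.+-identityʳ _) (ℤP.+-identityʳ _) ⟩
      Σ² (cube P L n) (Ψ +0 +0) ∎
      where open ≡-Reasoning

    Ψ-expand : ∀ a b → Ψ +0 +0 a b ≡ + P * + P * sqDist a b - (+ 2 * + P - + n) * sq (diffSum a b)
    Ψ-expand a b = trans
      (sum-cong-≗ {n} (λ i → cong (λ s → sq (+ P * (a i - b i) - s)) (ℤP.+-identityˡ (diffSum a b))))
      (∑-sq-scaled-minus-sum n (+ P) (λ i → a i - b i))

    Σ²-dist²≡ : Σ² (B P N) (dist² P) ≡ (+ P * + P - (+ 2 * + P - + n)) * Σ² (cube P L n) sqDist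
    Σ²-dist²≡ = begin
      Σ² (B P N) (dist² P)
        ≡⟨ Σ²-dist²-cube ⟩
      Σ² C (Ψ +0 +0)
        ≡⟨ Σ²-cong C (λ a b → trans (Ψ-expand a b) (split u v (sqDist a b) (sq (diffSum a b)))) ⟩
      Σ² C (λ a b → (u - v) * sqDist a b + - v * (sq (diffSum a b) - sqDist a b))
        ≡⟨ Σ²-distrib-+ C (λ a b → (u - v) * sqDist a b) _ ⟩
      Σ² C (λ a b → (u - v) * sqDist a b) + Σ² C (λ a b → - v * (sq (diffSum a b) - sqDist a b))
        ≡⟨ cong₂ _+_ (*-distribˡ-Σ² C (u - v) sqDist) (*-distribˡ-Σ² C (- v) (λ a b → sq (diffSum a b) - sqDist a b)) ⟨
      (u - v) * Σ² C sqDist + - v * Σ² C (λ a b → sq (diffSum a b) - sqDist a b)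
        ≡⟨ cong (λ s → (u - v) * Σ² C sqDist + - v * s) (Σ²-cube-[sq-diffSum-sqDist]≡0 P L n) ⟩
      (u - v) * Σ² C sqDist + - v * +0
        ≡⟨ drop (u - v) (Σ² C sqDist) v ⟩
      (u - v) * Σ² C sqDist ∎
      where
      open ≡-Reasoning
      C = cube P L n
      u = + P * + P
      v = + 2 * + P - + n
      split : ∀ u v q s → u * q - v * s ≡ (u - v) * q + - v * (s - q)
      split = solve-∀
      drop : ∀ c s v → c * s + - v * +0 ≡ c * s
      drop = solve-∀

    3Σ²-dist²≡ : + 3 * Σ² (B P N) (dist² P)
      ≡ + 2 * (((+ P) ℤ.^ 3 - + 2 * (+ P) ℤ.^ 2 + + 1) * (+ N * (+ N + + 1))) * sq (# cube P L n)
    3Σ²-dist²≡ = begin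
      + 3 * Σ² (B P N) (dist² P)
        ≡⟨ cong (+ 3 *_) (trans Σ²-dist²≡ (cong (c *_) (Σ²-sqDist-cube P L k))) ⟩
      + 3 * (c * (+ n * sq (# C) * spread L))
        ≡⟨ regroup c (+ n * sq (# C)) (spread L) ⟩
      c * (+ n * sq (# C)) * (+ 3 * spread L)
        ≡⟨ cong (c * (+ n * sq (# C)) *_) (spread-range P N) ⟩
      c * (+ n * sq (# C)) * (+ 2 * sq (# L) * K)
        ≡⟨ collect (+ n) (# L) (# C) K ⟩
      + 2 * (((+ P) ℤ.^ 3 - + 2 * (+ P) ℤ.^ 2 + + 1) * K) * sq (# L * # C)
        ≡⟨ cong (λ l → + 2 * (((+ P) ℤ.^ 3 - + 2 * (+ P) ℤ.^ 2 + + 1) * K) * sq l) (#cube-suc P L k) ⟨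
      + 2 * (((+ P) ℤ.^ 3 - + 2 * (+ P) ℤ.^ 2 + + 1) * K) * sq (# cube P L n) ∎
      where
      open ≡-Reasoning
      C = cube P L k
      K = + N * (+ N + + 1)
      c = + P * + P - (+ 2 * + P - + n)
      regroup : ∀ c d w → + 3 * (c * (d * w)) ≡ c * d * (+ 3 * w)
      regroup = solve-∀
      collect : ∀ n l c K → let P = + 1 + n in
        (P * P - (+ 2 * P - n)) * (n * (c * c)) * (+ 2 * (l * l) * K)
          ≡ + 2 * ((P * (P * (P * + 1)) - + 2 * (P * (P * + 1)) + + 1) * K) * ((l * c) * (l * c))
      collect = solve-∀

  -- fromℚᵘ (mkℚᵘ i d) is i / suc d by definition.
  toℚᵘ-/ : ∀ i d → toℚᵘ (i ℚ./ suc d) ≃ᵘ mkℚᵘ i d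
  toℚᵘ-/ i d = ℚP.toℚᵘ-fromℚᵘ (mkℚᵘ i d)

  -- The right-hand side of the formula for M₂, with x = p³, y = 2p², K = N(N+1).
  main-term : ℤ → ℤ → ℤ → ℚ
  main-term x y K = ((+ 2 ℚ./ 3) ℚ.* (((x ℚ./ 1) ℚ.- (y ℚ./ 1)) ℚ.+ (+ 1 ℚ./ 1))) ℚ.* (K ℚ./ 1)

  two-thirds : ℤ → ℚ
  two-thirds g = (+ 2 ℚ./ 3) ℚ.* (g ℚ./ 1)

  toℚᵘ-main-term : ∀ x y K → toℚᵘ (main-term x y K) ≃ᵘ mkℚᵘ (+ 2 * ((x - y + + 1) * K)) 2
  toℚᵘ-main-term x y K = ℚᵘP.≃-trans pushed (*≡* (normal-form x y K))
    where
    open ℚᵘP using (≃-trans; +-cong; -‿cong; *-cong)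
    pushed : toℚᵘ (main-term x y K)
      ≃ᵘ (mkℚᵘ (+ 2) 2 ℚᵘ.* ((mkℚᵘ x 0 ℚᵘ.- mkℚᵘ y 0) ℚᵘ.+ mkℚᵘ (+ 1) 0)) ℚᵘ.* mkℚᵘ K 0
    pushed = ≃-trans (ℚP.toℚᵘ-homo-* (⅔ ℚ.* s) (K ℚ./ 1)) (*-cong (≃-trans (ℚP.toℚᵘ-homo-* ⅔ s) (*-cong (toℚᵘ-/ (+ 2) 2)
      (≃-trans (ℚP.toℚᵘ-homo-+ d (+ 1 ℚ./ 1)) (+-cong (≃-trans (ℚP.toℚᵘ-homo-+ (x ℚ./ 1) (ℚ.- (y ℚ./ 1)))
        (+-cong (toℚᵘ-/ x 0) (≃-trans (ℚP.toℚᵘ-homo‿- (y ℚ./ 1)) (-‿cong (toℚᵘ-/ y 0))))) (toℚᵘ-/ (+ 1) 0)))))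
      (toℚᵘ-/ K 0))
      where
      ⅔ = + 2 ℚ./ 3
      d = (x ℚ./ 1) ℚ.- (y ℚ./ 1)
      s = d ℚ.+ (+ 1 ℚ./ 1)
    -- ↥ of the right-hand side of pushed, as ℚᵘ arithmetic computes it
    normal-form : ∀ x y K → (+ 2 * ((x * + 1 + - y * + 1) * + 1 + + 1 * + 1) * K) * + 3 ≡ + 2 * ((x - y + + 1) * K) * + 3
    normal-form = solve-∀

  toℚᵘ-two-thirds : ∀ g → toℚᵘ (two-thirds g) ≃ᵘ mkℚᵘ (+ 2 * g) 2
  toℚᵘ-two-thirds g =
    ℚᵘP.≃-trans (ℚP.toℚᵘ-homo-* (+ 2 ℚ./ 3) (g ℚ./ 1)) (ℚᵘP.*-cong (toℚᵘ-/ (+ 2) 2) (toℚᵘ-/ g 0))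

  /≡main-term : ∀ t D .{{_ : NonZero D}} x y K → + 3 * t ≡ + 2 * ((x - y + + 1) * K) * + D → t ℚ./ D ≡ main-term x y K
  /≡main-term t (suc d) x y K 3t≡ = ℚP.toℚᵘ-injective (ℚᵘP.≃-trans (toℚᵘ-/ t d)
    (ℚᵘP.≃-trans (*≡* (trans (ℤP.*-comm t (+ 3)) 3t≡)) (ℚᵘP.≃-sym (toℚᵘ-main-term x y K))))

  ∣main-term-two-thirds∣≤ : ∀ x y K g Y → ℤ.∣ (x - y + + 1) * K - g ∣ ℕ.≤ 3 ℕ.* Y →
    ℚ.∣ main-term x y K ℚ.- two-thirds g ∣ ℚ.≤ (+ 2 ℚ./ 1) ℚ.* (+ Y ℚ./ 1)
  ∣main-term-two-thirds∣≤ x y K g Y bound =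
    ℚP.toℚᵘ-cancel-≤ (ℚᵘP.≤-respˡ-≃ (ℚᵘP.≃-sym lhs≃) (ℚᵘP.≤-respʳ-≃ (ℚᵘP.≃-sym rhs≃) (*≤* scaled)))
    where
    open ℚᵘP using (≃-trans; +-cong; -‿cong; *-cong)
    e = (x - y + + 1) * K
    difference : ∀ e g → (+ 2 * e * + 3 + - (+ 2 * g) * + 3) * + 3 ≡ + 2 * (e - g) * + 9
    difference = solve-∀
    lhs≃ : toℚᵘ (ℚ.∣ main-term x y K ℚ.- two-thirds g ∣) ≃ᵘ mkℚᵘ (+ ℤ.∣ + 2 * (e - g) ∣) 2
    lhs≃ = ≃-trans (ℚP.toℚᵘ-homo-∣-∣ (main-term x y K ℚ.- two-thirds g)) (ℚᵘP.∣-∣-cong difference≃)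
      where
      difference≃ : toℚᵘ (main-term x y K ℚ.- two-thirds g) ≃ᵘ mkℚᵘ (+ 2 * (e - g)) 2
      difference≃ = ≃-trans (ℚP.toℚᵘ-homo-+ (main-term x y K) (ℚ.- two-thirds g))
        (≃-trans (+-cong (toℚᵘ-main-term x y K) (≃-trans (ℚP.toℚᵘ-homo‿- (two-thirds g)) (-‿cong (toℚᵘ-two-thirds g))))
          (*≡* (difference e g)))
    rhs≃ : toℚᵘ ((+ 2 ℚ./ 1) ℚ.* (+ Y ℚ./ 1)) ≃ᵘ mkℚᵘ (+ 2 * + Y) 0
    rhs≃ = ≃-trans (ℚP.toℚᵘ-homo-* (+ 2 ℚ./ 1) (+ Y ℚ./ 1)) (*-cong (toℚᵘ-/ (+ 2) 0) (toℚᵘ-/ (+ Y) 0))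
    scaled : + ℤ.∣ + 2 * (e - g) ∣ * + 1 ℤ.≤ (+ 2 * + Y) * + 3
    scaled = begin
      + ℤ.∣ + 2 * (e - g) ∣ * + 1 ≡⟨ ℤP.*-identityʳ _ ⟩
      + ℤ.∣ + 2 * (e - g) ∣       ≡⟨ cong +_ (ℤP.abs-* (+ 2) (e - g)) ⟩
      + (2 ℕ.* ℤ.∣ e - g ∣)       ≤⟨ ℤ.+≤+ (ℕP.*-monoʳ-≤ 2 bound) ⟩
      + (2 ℕ.* (3 ℕ.* Y))         ≡⟨ trans (ℤP.pos-* 2 (3 ℕ.* Y)) (cong (+ 2 *_) (ℤP.pos-* 3 Y)) ⟩
      + 2 * (+ 3 * + Y)           ≡⟨ regroup (+ Y) ⟩
      (+ 2 * + Y) * + 3           ∎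
      where
      open ℤP.≤-Reasoning
      regroup : ∀ y → + 2 * (+ 3 * y) ≡ (+ 2 * y) * + 3
      regroup = solve-∀

  pos-^ : ∀ m j → + (m ^ j) ≡ (+ m) ℤ.^ j
  pos-^ m zero    = refl
  pos-^ m (suc j) = trans (ℤP.pos-* m (m ^ j)) (cong (λ t → + m * t) (pos-^ m j))

  M₂≡main-term : ∀ k (P-prime : Prime (2 ℕ.+ k)) N → let P = 2 ℕ.+ k in
    M₂ P N ≡ main-term (+ (P ^ 3)) (+ (2 ℕ.* P ^ 2)) (+ (N ℕ.* (N ℕ.+ 1)))
  M₂≡main-term k P-prime N = /≡main-term (Σ² (B P N) (dist² P)) (cardB P N ℕ.* cardB P N) x y K (begin
    + 3 * Σ² (B P N) (dist² P)
      ≡⟨ 3Σ²-dist²≡ ⟩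
    + 2 * (((+ P) ℤ.^ 3 - + 2 * (+ P) ℤ.^ 2 + + 1) * (+ N * (+ N + + 1))) * sq (# cube P L n)
      ≡⟨ cong₂ (λ u v → + 2 * ((u - v + + 1) * (+ N * (+ N + + 1))) * sq (# cube P L n))
           (pos-^ P 3) (trans (ℤP.pos-* 2 (P ^ 2)) (cong (+ 2 *_) (pos-^ P 2))) ⟨
    + 2 * ((x - y + + 1) * (+ N * (+ N + + 1))) * sq (# cube P L n)
      ≡⟨ cong₂ (λ K c → + 2 * ((x - y + + 1) * K) * sq c) (sym (ℤP.pos-* N (N ℕ.+ 1))) #cube≡cardB ⟩
    + 2 * ((x - y + + 1) * K) * sq (+ cardB P N)
      ≡⟨ cong (λ D → + 2 * ((x - y + + 1) * K) * D) (ℤP.pos-* (cardB P N) (cardB P N)) ⟨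
    + 2 * ((x - y + + 1) * K) * + (cardB P N ℕ.* cardB P N) ∎)
    where
    open Trace k P-prime using (P; n)
    open Moment k P-prime N using (L; 3Σ²-dist²≡)
    open ≡-Reasoning
    x = + (P ^ 3)
    y = + (2 ℕ.* P ^ 2)
    K = + (N ℕ.* (N ℕ.+ 1))
    instance
      cardB²≢0 : NonZero (cardB P N ℕ.* cardB P N)
      cardB²≢0 = ℕP.m*n≢0 _ _ {{ℕP.m^n≢0 (suc (2 ℕ.* N)) n}} {{ℕP.m^n≢0 (suc (2 ℕ.* N)) n}}
    #cube≡cardB : # cube P L n ≡ + cardB P N
    #cube≡cardB = cong +_ (trans (length-cube P L n) (cong (ℕ._^ n) (ℤP.+-injective (#range P N))))

  -- The error term

  deviation≡ : ∀ P N →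
    (+ (P ^ 3) - + (2 ℕ.* P ^ 2) + + 1) * + (N ℕ.* (N ℕ.+ 1)) - + (P ^ 3 ℕ.* N ^ 2)
      ≡ + (P ^ 3 ℕ.* N ℕ.+ N ℕ.* (N ℕ.+ 1)) - + (2 ℕ.* P ^ 2 ℕ.* (N ℕ.* (N ℕ.+ 1)))
  deviation≡ P N = begin
    (x - y + + 1) * + (N ℕ.* (N ℕ.+ 1)) - + (P ^ 3 ℕ.* N ^ 2)
      ≡⟨ cong₂ (λ K g → (x - y + + 1) * K - g) (ℤP.pos-* N (N ℕ.+ 1))
           (trans (ℤP.pos-* (P ^ 3) (N ^ 2)) (cong (x *_) (pos-^ N 2))) ⟩
    (x - y + + 1) * (+ N * (+ N + + 1)) - x * (+ N * (+ N * + 1))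
      ≡⟨ rearrange x y (+ N) ⟩
    (x * + N + + N * (+ N + + 1)) - y * (+ N * (+ N + + 1))
      ≡⟨ cong₂ (λ a b → a - y * b) (cong₂ _+_ (ℤP.pos-* (P ^ 3) N) (ℤP.pos-* N (N ℕ.+ 1))) (ℤP.pos-* N (N ℕ.+ 1)) ⟨
    + (P ^ 3 ℕ.* N ℕ.+ N ℕ.* (N ℕ.+ 1)) - y * + (N ℕ.* (N ℕ.+ 1))
      ≡⟨ cong (λ b → + (P ^ 3 ℕ.* N ℕ.+ N ℕ.* (N ℕ.+ 1)) - b) (ℤP.pos-* (2 ℕ.* P ^ 2) (N ℕ.* (N ℕ.+ 1))) ⟨
    + (P ^ 3 ℕ.* N ℕ.+ N ℕ.* (N ℕ.+ 1)) - + (2 ℕ.* P ^ 2 ℕ.* (N ℕ.* (N ℕ.+ 1))) ∎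
    where
    open ≡-Reasoning
    x = + (P ^ 3)
    y = + (2 ℕ.* P ^ 2)
    rearrange : ∀ x y n → (x - y + + 1) * (n * (n + + 1)) - x * (n * (n * + 1)) ≡ (x * n + n * (n + + 1)) - y * (n * (n + + 1))
    rearrange = solve-∀

  deviation-parts≤ : ∀ P N → 2 ℕ.≤ P → 1 ℕ.≤ N →
    (P ^ 3 ℕ.* N ℕ.+ N ℕ.* (N ℕ.+ 1)) ℕ.+ 2 ℕ.* P ^ 2 ℕ.* (N ℕ.* (N ℕ.+ 1))
      ℕ.≤ 3 ℕ.* (P ^ 2 ℕ.* N ^ 2 ℕ.+ P ^ 3 ℕ.* N)
  -- Matching on 2 ≤ P exposes P = 2 + _, which the NonZero instances below need.
  deviation-parts≤ P N 2≤P@(s≤s (s≤s z≤n)) 1≤N = ℕP.+-mono-≤ first≤Y second≤2Y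
    where
    open ℕP.≤-Reasoning
    Y = P ^ 2 ℕ.* N ^ 2 ℕ.+ P ^ 3 ℕ.* N
    N+1≤P²N : N ℕ.+ 1 ℕ.≤ P ^ 2 ℕ.* N
    N+1≤P²N = begin
      N ℕ.+ 1     ≤⟨ ℕP.+-monoʳ-≤ N 1≤N ⟩
      N ℕ.+ N     ≡⟨ cong (N ℕ.+_) (ℕP.+-identityʳ N) ⟨
      2 ℕ.* N     ≤⟨ ℕP.*-monoˡ-≤ N (ℕP.≤-trans 2≤P (ℕP.m≤m*n P (P ℕ.* 1))) ⟩
      P ^ 2 ℕ.* N ∎
    first≤Y : P ^ 3 ℕ.* N ℕ.+ N ℕ.* (N ℕ.+ 1) ℕ.≤ Y
    first≤Y = begin
      P ^ 3 ℕ.* N ℕ.+ N ℕ.* (N ℕ.+ 1)         ≤⟨ ℕP.+-monoʳ-≤ (P ^ 3 ℕ.* N) (ℕP.*-monoʳ-≤ N N+1≤P²N) ⟩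
      P ^ 3 ℕ.* N ℕ.+ N ℕ.* (P ^ 2 ℕ.* N)     ≡⟨ square P N ⟩
      Y                                       ∎
      where
      square : ∀ P N → let P² = P ℕ.* (P ℕ.* 1); P³ = P ℕ.* P² in
        P³ ℕ.* N ℕ.+ N ℕ.* (P² ℕ.* N) ≡ P² ℕ.* (N ℕ.* (N ℕ.* 1)) ℕ.+ P³ ℕ.* N
      square = ℕ-Solver.solve-∀
    second≤2Y : 2 ℕ.* P ^ 2 ℕ.* (N ℕ.* (N ℕ.+ 1)) ℕ.≤ 2 ℕ.* Y
    second≤2Y = begin
      2 ℕ.* P ^ 2 ℕ.* (N ℕ.* (N ℕ.+ 1))        ≡⟨ expand P N ⟩
      2 ℕ.* (P ^ 2 ℕ.* N ^ 2 ℕ.+ P ^ 2 ℕ.* N)   ≤⟨ ℕP.*-monoʳ-≤ 2 (ℕP.+-monoʳ-≤ (P ^ 2 ℕ.* N ^ 2) P²N≤P³N) ⟩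
      2 ℕ.* Y                                  ∎
      where
      P²N≤P³N : P ^ 2 ℕ.* N ℕ.≤ P ^ 3 ℕ.* N
      P²N≤P³N = ℕP.≤-trans (ℕP.m≤n*m (P ^ 2 ℕ.* N) P) (ℕP.≤-reflexive (sym (ℕP.*-assoc P (P ^ 2) N)))
      expand : ∀ P N → let P² = P ℕ.* (P ℕ.* 1) in
        2 ℕ.* P² ℕ.* (N ℕ.* (N ℕ.+ 1)) ≡ 2 ℕ.* (P² ℕ.* (N ℕ.* (N ℕ.* 1)) ℕ.+ P² ℕ.* N)
      expand = ℕ-Solver.solve-∀

  ∣deviation∣≤ : ∀ P N → 2 ℕ.≤ P → 1 ℕ.≤ N →
    ℤ.∣ (+ (P ^ 3) - + (2 ℕ.* P ^ 2) + + 1) * + (N ℕ.* (N ℕ.+ 1)) - + (P ^ 3 ℕ.* N ^ 2) ∣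
      ℕ.≤ 3 ℕ.* (P ^ 2 ℕ.* N ^ 2 ℕ.+ P ^ 3 ℕ.* N)
  ∣deviation∣≤ P N 2≤P 1≤N = ℕP.≤-trans
    (subst (λ d → ℤ.∣ d ∣ ℕ.≤ U ℕ.+ V) (sym (deviation≡ P N)) (ℤP.∣i-j∣≤∣i∣+∣j∣ (+ U) (+ V)))
    (deviation-parts≤ P N 2≤P 1≤N)
    where
    U = P ^ 3 ℕ.* N ℕ.+ N ℕ.* (N ℕ.+ 1)
    V = 2 ℕ.* P ^ 2 ℕ.* (N ℕ.* (N ℕ.+ 1))

  ∣main-term-leading∣≤ : ∀ P N → 2 ℕ.≤ P → 1 ℕ.≤ N →
    ℚ.∣ main-term (+ (P ^ 3)) (+ (2 ℕ.* P ^ 2)) (+ (N ℕ.* (N ℕ.+ 1))) ℚ.- two-thirds (+ (P ^ 3 ℕ.* N ^ 2)) ∣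
      ℚ.≤ (+ 2 ℚ./ 1) ℚ.* (+ (P ^ 2 ℕ.* N ^ 2 ℕ.+ P ^ 3 ℕ.* N) ℚ./ 1)
  ∣main-term-leading∣≤ P N 2≤P 1≤N =
    ∣main-term-two-thirds∣≤ (+ (P ^ 3)) (+ (2 ℕ.* P ^ 2)) (+ (N ℕ.* (N ℕ.+ 1))) (+ (P ^ 3 ℕ.* N ^ 2))
      (P ^ 2 ℕ.* N ^ 2 ℕ.+ P ^ 3 ℕ.* N)
      (∣deviation∣≤ P N 2≤P 1≤N)

open import Data.Nat using (ℕ; _≤_; _^_)
open import Data.Nat.Primality using (Prime; prime⇒nonZero)
open import Data.Integer using (ℤ; +_)
open import Data.Rational using (ℚ; _/_; _*_; _-_; _+_; ∣_∣)
open import Data.Rational using () renaming (_≤_ to _≤ℚ_)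
open import Data.Product using (∃; _×_)
open import Relation.Binary.PropositionalEquality using (_≡_; _≢_)

lemma6p3 : ∃ λ (C : ℚ) → ∀ (p N : ℕ) (pr : Prime p) → p ≢ 2 → 1 ≤ N →
    (M₂ p {{prime⇒nonZero pr}} N
        ≡ ((+ 2 / 3) * (((+ (p ^ 3) / 1) - (+ (2 Data.Nat.* p ^ 2) / 1)) + (+ 1 / 1)))
          * (+ (N Data.Nat.* (N Data.Nat.+ 1)) / 1))
    × (∣ ((+ 2 / 3) * (((+ (p ^ 3) / 1) - (+ (2 Data.Nat.* p ^ 2) / 1)) + (+ 1 / 1)))
          * (+ (N Data.Nat.* (N Data.Nat.+ 1)) / 1)
          - (+ 2 / 3) * (+ (p ^ 3 Data.Nat.* N ^ 2) / 1) ∣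
        ≤ℚ C * (+ (p ^ 2 Data.Nat.* N ^ 2 Data.Nat.+ p ^ 3 Data.Nat.* N) / 1))
lemma6p3 = + 2 / 1 , λ where
  zero          _ pr _ _   → contradiction pr ¬prime[0]
  (suc zero)    _ pr _ _   → contradiction pr ¬prime[1]
  (suc (suc k)) N pr _ 1≤N →
    M₂≡main-term k pr N , ∣main-term-leading∣≤ (2 ℕ.+ k) N (s≤s (s≤s z≤n)) 1≤N
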